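{- Let $n\ge 2$, $1\le i\le n-1$, and let $\pi\in S_n$ be a permutation in which the value $i$ appears before the value $i+1$ in one-line notation (i.e. $\pi^{ -1}(i)<\pi^{ -1}(i+1)$). Let $\tau=(i,i+1)\circ\pi$ (so $\tau$ is obtained from $\pi$ by exchanging the values $i$ and $i+1$). Let $\lambda=\lambda(\pi)$ and $\mu=\lambda(\tau)$. Then for every $1\le j\le n$, \[ \sum_{m=1}^{j}\mu_m\;\le\;\sum_{m=1}^{j}\lambda_m\;\le\;\sum_{m=1}^{j}\mu_m+1 . \]
   Context: For $\pi\in S_n$, $\lambda(\pi)=(\lambda_1\ge\lambda_2\ge\cdots)$ denotes the shape (a partition of $n$) of the pair of standard Young tableaux associated with $\pi$ by the Robinson–Schensted–Knuth (RSK) correspondence; we set $\lambda_m=0$ for $m$ larger than the number of parts. The composition $(i,i+1)\circ\pi$ means first apply $\pi$ and then the transposition $(i,i+1)$. -}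

module Defs where

open import Data.Nat using (ℕ; zero; suc; _+_; _<ᵇ_)
open import Data.Bool using (if_then_else_)
open import Data.List using (List; []; _∷_; map; foldl)
import Data.List as List
open import Data.Maybe using (Maybe; just; nothing)
open import Data.Product using (_×_; _,_)
open import Data.Fin using (Fin; toℕ)
open import Data.Fin.Permutation using (Permutation′; _⟨$⟩ʳ_)
open import Data.List using (allFin)

-- One-line notation of a permutation of {1,…,n}: [π(1), …, π(n)],
-- where Fin n = {0,…,n-1} encodes {1,…,n} via k ↦ k+1.
oneLine : ∀ {n} → Permutation′ n → List ℕ
oneLine {n} π = map (λ k → suc (toℕ (π ⟨$⟩ʳ k))) (allFin n)

insertRow : ℕ → List ℕ → List ℕ × Maybe ℕ
insertRow x [] = (x ∷ [] , nothing)
insertRow x (y ∷ ys) with x <ᵇ y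
... | Data.Bool.true = (x ∷ ys , just y)
... | Data.Bool.false with insertRow x ys
...   | (r , b) = (y ∷ r , b)

-- RSK (Schensted) insertion of x into a tableau given as a list of rows (top row first).
insertTab : ℕ → List (List ℕ) → List (List ℕ)
insertTab x [] = (x ∷ []) ∷ []
insertTab x (r ∷ rs) with insertRow x r
... | (r' , nothing) = r' ∷ rs
... | (r' , just y)  = r' ∷ insertTab y rs

insertionTableau : List ℕ → List (List ℕ)
insertionTableau w = foldl (λ t x → insertTab x t) [] w

rskShape : ∀ {n} → Permutation′ n → List ℕ
rskShape π = map List.length (insertionTableau (oneLine π))

-- part λ m = λ_m  (1-based; λ_m = 0 beyond the number of parts, and for m = 0).
part : List ℕ → ℕ → ℕ
part []       _             = 0
part (x ∷ xs) zero          = 0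
part (x ∷ xs) (suc zero)    = x
part (x ∷ xs) (suc (suc m)) = part xs (suc m)

partialSum : List ℕ → ℕ → ℕ
partialSum l zero    = 0
partialSum l (suc j) = partialSum l j + part l (suc j)

module Submission where

-- Proof via Greene's theorem.  A k-family of a word is a labelling of its
-- letters by 0, 1, …, k (0 = unused) in which every nonzero class is an
-- increasing subsequence.  For a word w of distinct letters with RSK shape λ,
-- the largest k-family has size λ₁ + ⋯ + λ_k.
-- Exchanging the values a, a+1 of a word costs a k-family at most the letter
-- a+1, and costs nothing when a+1 precedes a.  Comparing the maximal
-- k-families of π and τ = (a,a+1)∘π in both directions gives the theorem.

open import Defs
open import Data.Nat using (ℕ; zero; suc; pred; _+_; _∸_; _⊓_; _≤_; _<_; z≤n; s≤s; _≟_; _<?_; _<ᵇ_)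
open import Data.Nat.Properties
open import Data.Bool using (true; false; T)
open import Data.Maybe using (Maybe; just; nothing)
open import Data.Product using (Σ; _×_; _,_; proj₁; proj₂)
open import Data.Empty using (⊥; ⊥-elim)
open import Data.Unit using (⊤; tt)
open import Data.List using (List; []; _∷_; _++_; map; length; foldl; allFin; take; drop)
open import Data.List.Properties using (∷-injectiveˡ; ∷-injectiveʳ; ++-assoc; ++-identityʳ; length-++; length-map; map-++; map-cong; map-∘; map-id)
open import Data.List.Relation.Unary.All using (All; []; _∷_) renaming (map to All-map)
import Data.List.Relation.Unary.All as All
import Data.List.Relation.Unary.All.Properties as AllP
open import Data.List.Relation.Unary.AllPairs using (AllPairs; []; _∷_) renaming (map to AllPairs-map)
import Data.List.Relation.Unary.AllPairs.Properties as AllPairsP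
open import Data.List.Relation.Unary.Unique.Propositional using (Unique)
open import Data.List.Relation.Binary.Permutation.Propositional using (_↭_; ↭-refl; ↭-sym; ↭-prep; ↭-swap; ↭⇒↭ₛ)
open import Data.List.Relation.Binary.Permutation.Propositional.Properties using (++⁺ˡ; ++⁺ʳ)
import Data.List.Relation.Binary.Permutation.Setoid.Properties as PermutationSetoid
open import Data.List.Relation.Binary.Sublist.Propositional using (_⊆_; []; _∷_; _∷ʳ_; ⊆-refl; minimum)
open import Data.List.Relation.Binary.Sublist.Propositional.Properties using (All-resp-⊆)
import Data.List.Relation.Binary.Sublist.Propositional.Properties as Sublist
open import Data.Fin using (Fin; inject₁; toℕ)
import Data.Fin
import Data.Fin.Properties as FinP
open import Data.Fin.Permutation using (Permutation′; _⟨$⟩ʳ_; _⟨$⟩ˡ_; _∘ₚ_; transpose; inverseˡ)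
import Data.Fin.Permutation.Components as PermC
open import Relation.Binary.PropositionalEquality
open import Algebra.Properties.CommutativeSemigroup +-commutativeSemigroup using (interchange)
open import Relation.Nullary using (¬_; yes; no)

Labelled : Set
Labelled = List (ℕ × ℕ)

values : Labelled → List ℕ
values = map proj₁

Above : ℕ → ℕ → Labelled → Set
Above l e = All (λ p → 0 < l → proj₂ p ≡ l → e < proj₁ p)

Chains : Labelled → Set
Chains [] = ⊤
Chains ((v , l) ∷ s) = Above l v s × Chains s

size : Labelled → ℕ
size [] = 0
size ((_ , zero) ∷ s) = size s
size ((_ , suc _) ∷ s) = suc (size s)

LabelsAtMost : ℕ → Labelled → Set
LabelsAtMost k = All (λ p → proj₂ p ≤ k)

record Family (k : ℕ) (w : List ℕ) (n : ℕ) : Set where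
  constructor family
  field
    L : Labelled
    values≡ : values L ≡ w
    chains : Chains L
    bounded : LabelsAtMost k L
    large : n ≤ size L

≡-family : ∀ {k u u' m} → u ≡ u' → Family k u m → Family k u' m
≡-family refl F = F

-- Every constraint that a preceding entry may impose on s is also met by s'.
-- This is what allows a suffix s of a family to be replaced by s'.
Relaxes : Labelled → Labelled → Set
Relaxes s s' = ∀ l e → Above l e s → Above l e s'

size-++ : ∀ p s → size (p ++ s) ≡ size p + size s
size-++ [] s = refl
size-++ ((_ , zero) ∷ p) s = size-++ p s
size-++ ((_ , suc _) ∷ p) s = cong suc (size-++ p s)

values-++ : ∀ p s → values (p ++ s) ≡ values p ++ values s
values-++ = map-++ proj₁

chains-suffix : ∀ p s → Chains (p ++ s) → Chains s
chains-suffix [] s c = c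
chains-suffix (_ ∷ p) s (_ , c) = chains-suffix p s c

chains-replace : ∀ p s s' → Chains (p ++ s) → Chains s' → Relaxes s s' → Chains (p ++ s')
chains-replace [] s s' _ c' _ = c'
chains-replace ((v , l) ∷ p) s s' (a , c) c' r =
  AllP.++⁺ (AllP.++⁻ˡ p a) (r l v (AllP.++⁻ʳ p a)) , chains-replace p s s' c c' r

split : ∀ (L : Labelled) u r → values L ≡ u ++ r →
  Σ Labelled λ Lu → Σ Labelled λ Lr → L ≡ Lu ++ Lr × values Lu ≡ u × values Lr ≡ r
split L [] r e = [] , L , refl , refl , e
split [] (x ∷ u) r ()
split (p ∷ L) (x ∷ u) r e with split L u r (∷-injectiveʳ e)
... | Lu , Lr , refl , refl , e₃ = p ∷ Lu , Lr , refl , cong (_∷ values Lu) (∷-injectiveˡ e) , e₃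

above-unused : ∀ e s → Above 0 e s
above-unused e [] = []
above-unused e (_ ∷ s) = (λ ()) ∷ above-unused e s

above-weaken : ∀ {l e e'} s → e' < e → Above l e s → Above l e' s
above-weaken [] _ [] = []
above-weaken (_ ∷ s) lt (a ∷ as) = (λ p q → <-trans lt (a p q)) ∷ above-weaken s lt as

swapℕ : ℕ → ℕ → ℕ → ℕ
swapℕ a b v with v ≟ a
... | yes _ = b
... | no _ with v ≟ b
...   | yes _ = a
...   | no _ = v

swap-cases : ∀ (P : ℕ → Set) a b v →
  (v ≡ a → P b) → (v ≡ b → P a) → (v ≢ a → v ≢ b → P v) → P (swapℕ a b v)
swap-cases P a b v pa pb po with v ≟ a
... | yes e = pa e
... | no n₁ with v ≟ b
...   | yes e = pb e
...   | no n₂ = po n₁ n₂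

swap-left : ∀ a b → swapℕ a b a ≡ b
swap-left a b = swap-cases (_≡ b) a b a (λ _ → refl) (λ e → e) (λ n _ → ⊥-elim (n refl))

swap-right : ∀ a b → a ≢ b → swapℕ a b b ≡ a
swap-right a b a≢b = swap-cases (_≡ a) a b b (λ e → ⊥-elim (a≢b (sym e))) (λ _ → refl) (λ _ n → ⊥-elim (n refl))

swap-other : ∀ a b v → v ≢ a → v ≢ b → swapℕ a b v ≡ v
swap-other a b v n₁ n₂ = swap-cases (_≡ v) a b v (λ e → ⊥-elim (n₁ e)) (λ e → ⊥-elim (n₂ e)) (λ _ _ → refl)

swap-involutive : ∀ a b v → a ≢ b → swapℕ a b (swapℕ a b v) ≡ v
swap-involutive a b v a≢b = swap-cases (λ u → swapℕ a b u ≡ v) a b v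
  (λ { refl → swap-right v b a≢b }) (λ { refl → swap-left a v }) (swap-other a b v)

swap-injective : ∀ a b u v → a ≢ b → swapℕ a b u ≡ swapℕ a b v → u ≡ v
swap-injective a b u v a≢b e =
  trans (sym (swap-involutive a b u a≢b)) (trans (cong (swapℕ a b) e) (swap-involutive a b v a≢b))

swap-zero : ∀ a b → 0 < a → 0 < b → swapℕ a b 0 ≡ 0
swap-zero a b 0<a 0<b = swap-other a b 0 (λ e → <-irrefl e 0<a) (λ e → <-irrefl e 0<b)

swap-positive : ∀ a b l → 0 < a → 0 < b → 0 < l → 0 < swapℕ a b l
swap-positive a b l 0<a 0<b 0<l = swap-cases (0 <_) a b l (λ _ → 0<b) (λ _ → 0<a) (λ _ _ → 0<l)

swap-bounded : ∀ a b l k → a ≤ k → b ≤ k → l ≤ k → swapℕ a b l ≤ k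
swap-bounded a b l k a≤k b≤k l≤k = swap-cases (_≤ k) a b l (λ _ → b≤k) (λ _ → a≤k) (λ _ _ → l≤k)

swapLabels : ℕ → ℕ → Labelled → Labelled
swapLabels S T = map (λ p → proj₁ p , swapℕ S T (proj₂ p))

module LabelSwap (S T : ℕ) (0<S : 0 < S) (0<T : 0 < T) (S≢T : S ≢ T) where

  positive-unswap : ∀ l → 0 < swapℕ S T l → 0 < l
  positive-unswap zero p rewrite swap-zero S T 0<S 0<T = p
  positive-unswap (suc l) _ = s≤s z≤n

  above-swap : ∀ m e s → Above m e s → Above (swapℕ S T m) e (swapLabels S T s)
  above-swap m e [] [] = []
  above-swap m e ((v , l) ∷ s) (a ∷ as) =
    (λ p q → a (positive-unswap m p) (swap-injective S T l m S≢T q)) ∷ above-swap m e s as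

  above-swap⁻ : ∀ l e s → Above (swapℕ S T l) e s → Above l e (swapLabels S T s)
  above-swap⁻ l e s a =
    subst (λ m → Above m e (swapLabels S T s)) (swap-involutive S T l S≢T) (above-swap (swapℕ S T l) e s a)

  chains-swap : ∀ s → Chains s → Chains (swapLabels S T s)
  chains-swap [] _ = tt
  chains-swap ((v , l) ∷ s) (a , c) = above-swap l v s a , chains-swap s c

  size-swap : ∀ s → size (swapLabels S T s) ≡ size s
  size-swap [] = refl
  size-swap ((v , zero) ∷ s) rewrite swap-zero S T 0<S 0<T = size-swap s
  size-swap ((v , suc l) ∷ s) with swapℕ S T (suc l) | swap-positive S T (suc l) 0<S 0<T (s≤s z≤n)
  ... | suc _ | _ = cong suc (size-swap s)

  bounded-swap : ∀ k s → S ≤ k → T ≤ k → LabelsAtMost k s → LabelsAtMost k (swapLabels S T s)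
  bounded-swap k [] _ _ [] = []
  bounded-swap k ((v , l) ∷ s) S≤k T≤k (b ∷ bs) = swap-bounded S T l k S≤k T≤k b ∷ bounded-swap k s S≤k T≤k bs

  values-swap : ∀ s → values (swapLabels S T s) ≡ values s
  values-swap [] = refl
  values-swap (_ ∷ s) = cong (_ ∷_) (values-swap s)

-- A relabelling Lr' of the word r' that may replace the labelled factor Lr of
-- any family: it is a chain family, relaxes Lr, and is at least as large.
Replacement : ℕ → Labelled → List ℕ → Set
Replacement k Lr r' = Σ Labelled λ Lr' →
  values Lr' ≡ r' × Chains Lr' × Relaxes Lr Lr' × LabelsAtMost k Lr' × size Lr ≤ size Lr'

Replaceable : ℕ → List ℕ → List ℕ → Set
Replaceable k r r' = ∀ Lr → values Lr ≡ r → Chains Lr → LabelsAtMost k Lr → Replacement k Lr r'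

family-replace : ∀ k u r r' n → Replaceable k r r' → Family k (u ++ r) n → Family k (u ++ r') n
family-replace k u r r' n ok (family L vl ch bd sz) with split L u r vl
... | Lu , Lr , refl , vu , vr with ok Lr vr (chains-suffix Lu Lr ch) (AllP.++⁻ʳ Lu bd)
...   | Lr' , vr' , ch' , rel , bd' , sz' =
  family (Lu ++ Lr') (trans (values-++ Lu Lr') (cong₂ _++_ vu vr')) (chains-replace Lu Lr Lr' ch ch' rel)
    (AllP.++⁺ (AllP.++⁻ˡ Lu bd) bd')
    (≤-trans sz (subst₂ _≤_ (sym (size-++ Lu Lr)) (sym (size-++ Lu Lr')) (+-monoʳ-≤ (size Lu) sz')))

replacement-cons : ∀ k c lc Lr r' → Above lc c Lr → lc ≤ k → Replacement k Lr r' →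
  Replacement k ((c , lc) ∷ Lr) (c ∷ r')
replacement-cons k c lc Lr r' a lc≤k (Lr' , vr , ch , rel , bd , sz) =
  (c , lc) ∷ Lr' , cong (c ∷_) vr , (rel lc c a , ch) , relaxes-cons , lc≤k ∷ bd , size-cons lc
  where
  relaxes-cons : Relaxes ((c , lc) ∷ Lr) ((c , lc) ∷ Lr')
  relaxes-cons l e (x ∷ xs) = x ∷ rel l e xs
  size-cons : ∀ l → size ((c , l) ∷ Lr) ≤ size ((c , l) ∷ Lr')
  size-cons zero = sz
  size-cons (suc _) = s≤s sz

exchange : ∀ k a la b lb r → (0 < la → la ≡ lb → ⊥) →
  Chains ((a , la) ∷ (b , lb) ∷ r) → LabelsAtMost k ((a , la) ∷ (b , lb) ∷ r) →
  Replacement k ((a , la) ∷ (b , lb) ∷ r) (b ∷ a ∷ values r)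
exchange k a la b lb r apart ((a₁ ∷ a₂) , (b₁ , c)) (ka ∷ kb ∷ kr) =
  (b , lb) ∷ (a , la) ∷ r , refl ,
  ((λ p q → ⊥-elim (apart (subst (0 <_) (sym q) p) q)) ∷ b₁ , (a₂ , c)) ,
  (λ { l e (x₁ ∷ x₂ ∷ x₃) → x₂ ∷ x₁ ∷ x₃ }) ,
  kb ∷ ka ∷ kr , ≤-reflexive (size-exchange la lb)
  where
  size-exchange : ∀ la lb → size ((a , la) ∷ (b , lb) ∷ r) ≡ size ((b , lb) ∷ (a , la) ∷ r)
  size-exchange zero zero = refl
  size-exchange zero (suc _) = refl
  size-exchange (suc _) zero = refl
  size-exchange (suc _) (suc _) = refl

-- K1, x z y ↦ z x y, in the case where x and z share the class S.  If y is
-- unused, y takes the place of z in class S.  If y is in class T, then z joins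
-- class T and y class S, and the classes S and T are exchanged after y.
knuth₁-shared : ∀ k x y z S ly Lv → x < y → y < z →
  Chains ((x , suc S) ∷ (z , suc S) ∷ (y , ly) ∷ Lv) → LabelsAtMost k ((x , suc S) ∷ (z , suc S) ∷ (y , ly) ∷ Lv) →
  Replacement k ((x , suc S) ∷ (z , suc S) ∷ (y , ly) ∷ Lv) (z ∷ x ∷ y ∷ values Lv)
knuth₁-shared k x y z S zero Lv x<y y<z ((_ ∷ _ ∷ xL) , (_ ∷ zL) , _ , cL) (kS ∷ _ ∷ _ ∷ kL) =
  (z , 0) ∷ (x , suc S) ∷ (y , suc S) ∷ Lv , refl ,
  (above-unused z _ , ((λ _ _ → x<y) ∷ xL) , above-weaken Lv y<z zL , cL) ,
  (λ { l e (e₁ ∷ _ ∷ _ ∷ eL) → (λ p q → ⊥-elim (<-irrefl q p)) ∷ e₁ ∷ (λ p q → <-trans (e₁ p q) x<y) ∷ eL }) ,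
  z≤n ∷ kS ∷ kS ∷ kL , ≤-refl
knuth₁-shared k x y z S (suc T) Lv x<y y<z ((_ ∷ _ ∷ _) , (z₁ ∷ _) , _ , _) _ with suc T ≟ suc S
... | yes T≡S = ⊥-elim (<-asym y<z (z₁ (s≤s z≤n) T≡S))
knuth₁-shared k x y z S (suc T) Lv x<y y<z ((_ ∷ _ ∷ xL) , (_ ∷ zL) , yL , cL) (kS ∷ _ ∷ kT ∷ kL) | no T≢S =
  (z , suc T) ∷ (x , suc S) ∷ (y , suc S) ∷ swapLabels (suc S) (suc T) Lv ,
  cong (λ t → z ∷ x ∷ y ∷ t) (values-swap Lv) ,
  (((λ _ q → ⊥-elim (T≢S (sym q))) ∷ (λ _ q → ⊥-elim (T≢S (sym q))) ∷ above-swap⁻ (suc T) z Lv (in-class-S zL)) ,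
   ((λ _ _ → x<y) ∷ above-swap⁻ (suc S) x Lv (in-class-T (above-weaken Lv x<y yL))) ,
   above-swap⁻ (suc S) y Lv (in-class-T yL) ,
   chains-swap Lv cL) ,
  relaxes ,
  kT ∷ kS ∷ kS ∷ bounded-swap k Lv kS kT kL ,
  s≤s (s≤s (s≤s (≤-reflexive (sym (size-swap Lv)))))
  where
  S≢T : suc S ≢ suc T
  S≢T q = T≢S (sym q)
  open LabelSwap (suc S) (suc T) (s≤s z≤n) (s≤s z≤n) S≢T
  in-class-S : ∀ {e} → Above (suc S) e Lv → Above (swapℕ (suc S) (suc T) (suc T)) e Lv
  in-class-S = subst (λ m → Above m _ Lv) (sym (swap-right (suc S) (suc T) S≢T))
  in-class-T : ∀ {e} → Above (suc T) e Lv → Above (swapℕ (suc S) (suc T) (suc S)) e Lv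
  in-class-T = subst (λ m → Above m _ Lv) (sym (swap-left (suc S) (suc T)))
  relaxes : Relaxes ((x , suc S) ∷ (z , suc S) ∷ (y , suc T) ∷ Lv)
                    ((z , suc T) ∷ (x , suc S) ∷ (y , suc S) ∷ swapLabels (suc S) (suc T) Lv)
  relaxes l e (e₁ ∷ e₂ ∷ e₃ ∷ eL) =
    (λ p q → <-trans (e₃ p q) y<z) ∷ e₁ ∷ (λ p q → <-trans (e₁ p q) x<y) ∷ above-swap⁻ l e Lv rest
    where
    rest : Above (swapℕ (suc S) (suc T) l) e Lv
    rest = swap-cases (λ m → Above m e Lv) (suc S) (suc T) l
      (λ { refl → above-weaken Lv (<-trans (e₁ (s≤s z≤n) refl) x<y) yL })
      (λ { refl → above-weaken Lv (<-trans (e₃ (s≤s z≤n) refl) y<z) zL })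
      (λ _ _ → eL)

knuth₁-forward : ∀ k x y z lx lz ly Lv → x < y → y < z →
  Chains ((x , lx) ∷ (z , lz) ∷ (y , ly) ∷ Lv) → LabelsAtMost k ((x , lx) ∷ (z , lz) ∷ (y , ly) ∷ Lv) →
  Replacement k ((x , lx) ∷ (z , lz) ∷ (y , ly) ∷ Lv) (z ∷ x ∷ y ∷ values Lv)
knuth₁-forward k x y z zero lz ly Lv _ _ ch bd = exchange k x 0 z lz ((y , ly) ∷ Lv) (λ ()) ch bd
knuth₁-forward k x y z (suc S) lz ly Lv x<y y<z ch bd with lz ≟ suc S
... | no lz≢S = exchange k x (suc S) z lz ((y , ly) ∷ Lv) (λ _ q → lz≢S (sym q)) ch bd
... | yes refl = knuth₁-shared k x y z S ly Lv x<y y<z ch bd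

-- K2, y x z ↦ y z x, in the case where x and z share the class S.  If y is
-- unused, y takes the place of x in class S.  If y is in class T, then z joins
-- class T and x class S, and the classes S and T are exchanged after x.
knuth₂-shared : ∀ k x y z ly S Lv → x < y → y < z →
  Chains ((y , ly) ∷ (x , suc S) ∷ (z , suc S) ∷ Lv) → LabelsAtMost k ((y , ly) ∷ (x , suc S) ∷ (z , suc S) ∷ Lv) →
  Replacement k ((y , ly) ∷ (x , suc S) ∷ (z , suc S) ∷ Lv) (y ∷ z ∷ x ∷ values Lv)
knuth₂-shared k x y z zero S Lv x<y y<z (_ , (_ ∷ _) , zL , cL) (_ ∷ kS ∷ _ ∷ kL) =
  (y , suc S) ∷ (z , suc S) ∷ (x , 0) ∷ Lv , refl ,
  (((λ _ _ → y<z) ∷ (λ _ ()) ∷ above-weaken Lv y<z zL) , ((λ _ ()) ∷ zL) , above-unused x Lv , cL) ,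
  (λ { l e (_ ∷ e₂ ∷ e₃ ∷ eL) → (λ p q → <-trans (e₂ p q) x<y) ∷ e₃ ∷ (λ { p refl → ⊥-elim (<-irrefl refl p) }) ∷ eL }) ,
  kS ∷ kS ∷ z≤n ∷ kL , ≤-refl
knuth₂-shared k x y z (suc T) S Lv x<y y<z ((y₁ ∷ _) , _ , _ , _) _ with suc T ≟ suc S
... | yes T≡S = ⊥-elim (<-asym x<y (y₁ (s≤s z≤n) (sym T≡S)))
knuth₂-shared k x y z (suc T) S Lv x<y y<z ((_ ∷ _ ∷ yL) , (_ ∷ xL) , zL , cL) (kT ∷ kS ∷ _ ∷ kL) | no T≢S =
  (y , suc T) ∷ (z , suc T) ∷ (x , suc S) ∷ swapLabels (suc S) (suc T) Lv ,
  cong (λ t → y ∷ z ∷ x ∷ t) (values-swap Lv) ,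
  (((λ _ _ → y<z) ∷ (λ _ q → ⊥-elim (S≢T q)) ∷ above-swap⁻ (suc T) y Lv (in-class-S (above-weaken Lv y<z zL))) ,
   ((λ _ q → ⊥-elim (S≢T q)) ∷ above-swap⁻ (suc T) z Lv (in-class-S zL)) ,
   above-swap⁻ (suc S) x Lv (in-class-T (above-weaken Lv x<y yL)) ,
   chains-swap Lv cL) ,
  relaxes ,
  kT ∷ kT ∷ kS ∷ bounded-swap k Lv kS kT kL ,
  s≤s (s≤s (s≤s (≤-reflexive (sym (size-swap Lv)))))
  where
  S≢T : suc S ≢ suc T
  S≢T q = T≢S (sym q)
  open LabelSwap (suc S) (suc T) (s≤s z≤n) (s≤s z≤n) S≢T
  in-class-S : ∀ {e} → Above (suc S) e Lv → Above (swapℕ (suc S) (suc T) (suc T)) e Lv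
  in-class-S = subst (λ m → Above m _ Lv) (sym (swap-right (suc S) (suc T) S≢T))
  in-class-T : ∀ {e} → Above (suc T) e Lv → Above (swapℕ (suc S) (suc T) (suc S)) e Lv
  in-class-T = subst (λ m → Above m _ Lv) (sym (swap-left (suc S) (suc T)))
  relaxes : Relaxes ((y , suc T) ∷ (x , suc S) ∷ (z , suc S) ∷ Lv)
                    ((y , suc T) ∷ (z , suc T) ∷ (x , suc S) ∷ swapLabels (suc S) (suc T) Lv)
  relaxes l e (e₁ ∷ e₂ ∷ e₃ ∷ eL) = e₁ ∷ (λ p q → <-trans (e₁ p q) y<z) ∷ e₂ ∷ above-swap⁻ l e Lv rest
    where
    rest : Above (swapℕ (suc S) (suc T) l) e Lv
    rest = swap-cases (λ m → Above m e Lv) (suc S) (suc T) l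
      (λ { refl → above-weaken Lv (<-trans (e₂ (s≤s z≤n) refl) x<y) yL })
      (λ { refl → above-weaken Lv (<-trans (e₁ (s≤s z≤n) refl) y<z) zL })
      (λ _ _ → eL)

knuth₂-forward : ∀ k x y z ly lx lz Lv → x < y → y < z →
  Chains ((y , ly) ∷ (x , lx) ∷ (z , lz) ∷ Lv) → LabelsAtMost k ((y , ly) ∷ (x , lx) ∷ (z , lz) ∷ Lv) →
  Replacement k ((y , ly) ∷ (x , lx) ∷ (z , lz) ∷ Lv) (y ∷ z ∷ x ∷ values Lv)
knuth₂-forward k x y z ly zero lz Lv _ _ (ay , rest) (ky ∷ kr) =
  replacement-cons k y ly _ _ ay ky (exchange k x 0 z lz Lv (λ ()) rest kr)
knuth₂-forward k x y z ly (suc S) lz Lv x<y y<z ch bd with lz ≟ suc S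
... | no lz≢S = replacement-cons k y ly _ _ (proj₁ ch) (All.head bd)
                  (exchange k x (suc S) z lz Lv (λ _ q → lz≢S (sym q)) (proj₂ ch) (All.tail bd))
... | yes refl = knuth₂-shared k x y z ly S Lv x<y y<z ch bd

-- The backward moves never break a class: the two exchanged letters z, x
-- cannot share a class since z comes first and z > x.
knuth₁-backward : ∀ k x y z lz lx ly Lv → x < y → y < z →
  Chains ((z , lz) ∷ (x , lx) ∷ (y , ly) ∷ Lv) → LabelsAtMost k ((z , lz) ∷ (x , lx) ∷ (y , ly) ∷ Lv) →
  Replacement k ((z , lz) ∷ (x , lx) ∷ (y , ly) ∷ Lv) (x ∷ z ∷ y ∷ values Lv)
knuth₁-backward k x y z lz lx ly Lv x<y y<z ch@((z₁ ∷ _) , _) bd =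
  exchange k z lz x lx ((y , ly) ∷ Lv) (λ p q → <-asym (<-trans x<y y<z) (z₁ p (sym q))) ch bd

knuth₂-backward : ∀ k x y z ly lz lx Lv → x < y → y < z →
  Chains ((y , ly) ∷ (z , lz) ∷ (x , lx) ∷ Lv) → LabelsAtMost k ((y , ly) ∷ (z , lz) ∷ (x , lx) ∷ Lv) →
  Replacement k ((y , ly) ∷ (z , lz) ∷ (x , lx) ∷ Lv) (y ∷ x ∷ z ∷ values Lv)
knuth₂-backward k x y z ly lz lx Lv x<y y<z (ay , rest@((z₁ ∷ _) , _)) (ky ∷ kr) =
  replacement-cons k y ly _ _ ay ky
    (exchange k z lz x lx Lv (λ p q → <-asym (<-trans x<y y<z) (z₁ p (sym q))) rest kr)

split-head : ∀ (L : Labelled) x r → values L ≡ x ∷ r →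
  Σ ℕ λ l → Σ Labelled λ Lr → L ≡ (x , l) ∷ Lr × values Lr ≡ r
split-head ((v , l) ∷ L) x r e with ∷-injectiveˡ e
... | refl = l , L , refl , ∷-injectiveʳ e

replaceable-head : ∀ k a b c v (f : List ℕ → List ℕ) →
  (∀ la lb lc Lv → Chains ((a , la) ∷ (b , lb) ∷ (c , lc) ∷ Lv) → LabelsAtMost k ((a , la) ∷ (b , lb) ∷ (c , lc) ∷ Lv) →
     Replacement k ((a , la) ∷ (b , lb) ∷ (c , lc) ∷ Lv) (f (values Lv))) →
  Replaceable k (a ∷ b ∷ c ∷ v) (f v)
replaceable-head k a b c v f core Lr e ch bd with split-head Lr _ _ e
... | la , L₁ , refl , e₁ with split-head L₁ _ _ e₁
... | lb , L₂ , refl , e₂ with split-head L₂ _ _ e₂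
... | lc , Lv , refl , refl = core la lb lc Lv ch bd

data KnuthMove : List ℕ → List ℕ → Set where
  K₁ : ∀ {x y z} → x < y → y < z → KnuthMove (x ∷ z ∷ y ∷ []) (z ∷ x ∷ y ∷ [])
  K₂ : ∀ {x y z} → x < y → y < z → KnuthMove (y ∷ x ∷ z ∷ []) (y ∷ z ∷ x ∷ [])

data KnuthStep : List ℕ → List ℕ → Set where
  forward  : ∀ u v {a b} → KnuthMove a b → KnuthStep (u ++ a ++ v) (u ++ b ++ v)
  backward : ∀ u v {a b} → KnuthMove a b → KnuthStep (u ++ b ++ v) (u ++ a ++ v)

infix 4 _~_
data _~_ : List ℕ → List ℕ → Set where
  ~refl : ∀ {w} → w ~ w
  ~step : ∀ {w w' w''} → KnuthStep w w' → w' ~ w'' → w ~ w''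

~trans : ∀ {a b c} → a ~ b → b ~ c → a ~ c
~trans ~refl q = q
~trans (~step s p) q = ~step s (~trans p q)

~single : ∀ {a b} → KnuthStep a b → a ~ b
~single s = ~step s ~refl

~sym : ∀ {a b} → a ~ b → b ~ a
~sym ~refl = ~refl
~sym (~step s p) = ~trans (~sym p) (~single (reverse s))
  where
  reverse : ∀ {a b} → KnuthStep a b → KnuthStep b a
  reverse (forward u v m) = backward u v m
  reverse (backward u v m) = forward u v m

≡⇒~ : ∀ {a b} → a ≡ b → a ~ b
≡⇒~ refl = ~refl

~prefix : ∀ p {a b} → a ~ b → (p ++ a) ~ (p ++ b)
~prefix p ~refl = ~refl
~prefix p (~step s q) = ~step (step-prefix s) (~prefix p q)
  where
  step-prefix : ∀ {a b} → KnuthStep a b → KnuthStep (p ++ a) (p ++ b)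
  step-prefix (forward u v m) = subst₂ KnuthStep (++-assoc p u _) (++-assoc p u _) (forward (p ++ u) v m)
  step-prefix (backward u v m) = subst₂ KnuthStep (++-assoc p u _) (++-assoc p u _) (backward (p ++ u) v m)

~suffix : ∀ q {a b} → a ~ b → (a ++ q) ~ (b ++ q)
~suffix q ~refl = ~refl
~suffix q (~step s r) = ~step (step-suffix s) (~suffix q r)
  where
  reassoc : ∀ u a v → u ++ a ++ v ++ q ≡ (u ++ a ++ v) ++ q
  reassoc u a v = trans (cong (u ++_) (sym (++-assoc a v q))) (sym (++-assoc u (a ++ v) q))
  step-suffix : ∀ {a b} → KnuthStep a b → KnuthStep (a ++ q) (b ++ q)
  step-suffix (forward u v {a} {b} m) = subst₂ KnuthStep (reassoc u a v) (reassoc u b v) (forward u (v ++ q) m)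
  step-suffix (backward u v {a} {b} m) = subst₂ KnuthStep (reassoc u b v) (reassoc u a v) (backward u (v ++ q) m)

Distinct : List ℕ → Set
Distinct = Unique

~distinct : ∀ {a b} → a ~ b → Distinct a → Distinct b
~distinct ~refl d = d
~distinct (~step s p) d = ~distinct p (PermutationSetoid.Unique-resp-↭ (setoid ℕ) (↭⇒↭ₛ (step-permutes s)) d)
  where
  move-permutes : ∀ {a b} → KnuthMove a b → a ↭ b
  move-permutes (K₁ {x} {y} {z} _ _) = ↭-swap x z ↭-refl
  move-permutes (K₂ {x} {y} {z} _ _) = ↭-prep y (↭-swap x z ↭-refl)
  step-permutes : ∀ {a b} → KnuthStep a b → a ↭ b
  step-permutes (forward u v m) = ++⁺ˡ u (++⁺ʳ v (move-permutes m))
  step-permutes (backward u v m) = ++⁺ˡ u (++⁺ʳ v (↭-sym (move-permutes m)))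

~family : ∀ {k w w' n} → w ~ w' → Family k w n → Family k w' n
~family ~refl F = F
~family {k} {n = n} (~step s p) F = ~family p (step-family s F)
  where
  move-replaceable : ∀ {a b} v → KnuthMove a b → Replaceable k (a ++ v) (b ++ v) × Replaceable k (b ++ v) (a ++ v)
  move-replaceable v (K₁ {x} {y} {z} x<y y<z) =
    replaceable-head k x z y v (λ t → z ∷ x ∷ y ∷ t) (λ la lb lc Lv → knuth₁-forward k x y z la lb lc Lv x<y y<z) ,
    replaceable-head k z x y v (λ t → x ∷ z ∷ y ∷ t) (λ la lb lc Lv → knuth₁-backward k x y z la lb lc Lv x<y y<z)
  move-replaceable v (K₂ {x} {y} {z} x<y y<z) =
    replaceable-head k y x z v (λ t → y ∷ z ∷ x ∷ t) (λ la lb lc Lv → knuth₂-forward k x y z la lb lc Lv x<y y<z) ,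
    replaceable-head k y z x v (λ t → y ∷ x ∷ z ∷ t) (λ la lb lc Lv → knuth₂-backward k x y z la lb lc Lv x<y y<z)
  step-family : ∀ {w w'} → KnuthStep w w' → Family k w n → Family k w' n
  step-family (forward u v m) = family-replace k u _ _ n (proj₁ (move-replaceable v m))
  step-family (backward u v m) = family-replace k u _ _ n (proj₂ (move-replaceable v m))

Increasing : List ℕ → Set
Increasing = AllPairs _<_

data RowInsertion (x : ℕ) : List ℕ → List ℕ × Maybe ℕ → Set where
  bump   : ∀ {y ys} → x < y → RowInsertion x (y ∷ ys) (x ∷ ys , just y)
  append : RowInsertion x [] (x ∷ [] , nothing)
  pass   : ∀ {y ys r b} → y ≤ x → RowInsertion x ys (r , b) → RowInsertion x (y ∷ ys) (y ∷ r , b)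

rowInsertion : ∀ x R → RowInsertion x R (insertRow x R)
rowInsertion x [] = append
rowInsertion x (y ∷ ys) with x <ᵇ y in eq
... | true = bump (<ᵇ⇒< x y (subst T (sym eq) tt))
... | false with insertRow x ys | rowInsertion x ys
...   | (r , b) | v = pass (≮⇒≥ (λ lt → subst T eq (<⇒<ᵇ lt))) v

bumped-greater : ∀ {x R r y} → RowInsertion x R (r , just y) → x < y
bumped-greater (bump lt) = lt
bumped-greater (pass _ v) = bumped-greater v

inserted-all : ∀ {P : ℕ → Set} {x R r b} → P x → All P R → RowInsertion x R (r , b) → All P r
inserted-all px (_ ∷ ps) (bump _) = px ∷ ps
inserted-all px [] append = px ∷ []
inserted-all px (p ∷ ps) (pass _ v) = p ∷ inserted-all px ps v

bumped-from : ∀ {P : ℕ → Set} {x R r y} → All P R → RowInsertion x R (r , just y) → P y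
bumped-from (p ∷ _) (bump _) = p
bumped-from (_ ∷ ps) (pass _ v) = bumped-from ps v

appended : ∀ {x R R'} → RowInsertion x R (R' , nothing) → R' ≡ R ++ x ∷ []
appended append = refl
appended (pass _ v) = cong (_ ∷_) (appended v)

row-increasing : ∀ {x R R' b} → Increasing R → All (_≢ x) R → RowInsertion x R (R' , b) → Increasing R'
row-increasing (a ∷ p) _ (bump lt) = All-map (<-trans lt) a ∷ p
row-increasing _ _ append = [] ∷ []
row-increasing (a ∷ p) (n ∷ ns) (pass le v) = inserted-all (≤∧≢⇒< le n) a v ∷ row-increasing p ns v

slide-left : ∀ x y B → x < y → Increasing (y ∷ B) → (y ∷ B ++ x ∷ []) ~ (y ∷ x ∷ B)
slide-left x y [] _ _ = ~refl
slide-left x y (b ∷ B) x<y ((y<b ∷ _) ∷ iB) =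
  ~trans (~prefix (y ∷ []) (slide-left x b B (<-trans x<y y<b) iB))
         (~single (backward [] B (K₂ x<y y<b)))

row-knuth : ∀ {x R R' y} → Increasing R → All (_≢ x) R → RowInsertion x R (R' , just y) → (R ++ x ∷ []) ~ (y ∷ R')
row-knuth {x} {y ∷ ys} iR _ (bump lt) = slide-left x y ys lt iR
row-knuth {x} {u ∷ us} {R'} {y} (a ∷ iR) (n ∷ ns) (pass le v) =
  ~trans (~prefix (u ∷ []) (row-knuth iR ns v)) (move-past (inserted-all {P = u <_} (≤∧≢⇒< le n) a v) v)
  where
  head-below : ∀ {c r} → RowInsertion x us (c ∷ r , just y) → c < y
  head-below (bump lt) = lt
  head-below (pass c≤x w) = ≤-<-trans c≤x (bumped-greater w)
  move-past : ∀ {r} → All (u <_) r → RowInsertion x us (r , just y) → (u ∷ y ∷ r) ~ (y ∷ u ∷ r)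
  move-past (u<c ∷ _) w = ~single (forward [] _ (K₁ u<c (head-below w)))

reading : List (List ℕ) → List ℕ
reading [] = []
reading (R ∷ T) = reading T ++ R

Below : List ℕ → List ℕ → Set
Below _ [] = ⊤
Below [] (_ ∷ _) = ⊥
Below (a ∷ as) (b ∷ bs) = a < b × Below as bs

BelowFirst : List ℕ → List (List ℕ) → Set
BelowFirst R [] = ⊤
BelowFirst R (L ∷ _) = Below R L

data Tableau : List (List ℕ) → Set where
  []  : Tableau []
  _∷_ : ∀ {R T} → Increasing R × BelowFirst R T → Tableau T → Tableau (R ∷ T)

rows-increasing : ∀ {T} → Tableau T → All Increasing T
rows-increasing [] = []
rows-increasing ((iR , _) ∷ t) = iR ∷ rows-increasing t

Dominated : List ℕ → List ℕ → Set
Dominated _ [] = ⊤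
Dominated [] (_ ∷ _) = ⊥
Dominated (a' ∷ as') (a ∷ as) = a' ≤ a × Dominated as' as

-- Row insertion only decreases entries, so it keeps a row above the next one.
dominated-refl : ∀ U → Dominated U U
dominated-refl [] = tt
dominated-refl (a ∷ U) = ≤-refl , dominated-refl U

inserted-dominated : ∀ {x U U' b} → RowInsertion x U (U' , b) → Dominated U' U
inserted-dominated (bump lt) = <⇒≤ lt , dominated-refl _
inserted-dominated append = tt
inserted-dominated (pass _ v) = ≤-refl , inserted-dominated v

below-dominated : ∀ U' U L → Dominated U' U → Below U L → Below U' L
below-dominated U' U [] _ _ = tt
below-dominated [] (_ ∷ _) (_ ∷ _) () _
below-dominated (a' ∷ U') (a ∷ U) (b ∷ L) (le , les) (lt , bs) = ≤-<-trans le lt , below-dominated U' U L les bs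

belowFirst-dominated : ∀ U' U T → Dominated U' U → BelowFirst U T → BelowFirst U' T
belowFirst-dominated U' U [] _ _ = tt
belowFirst-dominated U' U (L ∷ _) le b = below-dominated U' U L le b

below-insert : ∀ {x y U U' L L' b} → Below U L → Increasing U →
  RowInsertion x U (U' , just y) → RowInsertion y L (L' , b) → Below U' L'
below-insert {L = []} _ _ (bump lt) append = lt , tt
below-insert {L = _ ∷ _} (_ , bs) _ (bump lt) (bump _) = lt , bs
below-insert {L = _ ∷ _} (ul , _) _ (bump lt) (pass le _) = ⊥-elim (<-irrefl refl (<-≤-trans ul le))
below-insert {L = []} _ (a ∷ _) (pass _ v) append = bumped-from a v , tt
below-insert {U = _ ∷ Us} {L = _ ∷ Ls} (_ , bs) (a ∷ _) (pass _ v) (bump _) =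
  bumped-from a v , below-dominated _ Us Ls (inserted-dominated v) bs
below-insert {L = _ ∷ _} (ul , bs) (_ ∷ iU) (pass _ v) (pass _ w) = ul , below-insert bs iU v w

firstRow : List (List ℕ) → List ℕ
firstRow [] = []
firstRow (R ∷ _) = R

insert-firstRow : ∀ y T → Σ (List ℕ × Maybe ℕ) λ res → RowInsertion y (firstRow T) res × firstRow (insertTab y T) ≡ proj₁ res
insert-firstRow y [] = _ , append , refl
insert-firstRow y (L ∷ T) with insertRow y L | rowInsertion y L
... | (L' , nothing) | v = _ , v , refl
... | (L' , just z) | v = _ , v , refl

belowFirst-insert : ∀ {x y U U'} T → BelowFirst U T → Increasing U → RowInsertion x U (U' , just y) →
  BelowFirst U' (insertTab y T)
belowFirst-insert {y = y} T b iU v with insertTab y T | insert-firstRow y T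
... | [] | _ = tt
... | (L' ∷ _) | ((.L' , _) , w , refl) = below-insert (first T b) iU v w
  where
  first : ∀ {U} T → BelowFirst U T → Below U (firstRow T)
  first [] _ = tt
  first (_ ∷ _) b = b

distinct-++⁻ : ∀ xs {ys} → Distinct (xs ++ ys) → Distinct xs × All (λ a → All (a ≢_) ys) xs
distinct-++⁻ [] _ = [] , []
distinct-++⁻ (x ∷ xs) (a ∷ d) =
  let dxs , cross = distinct-++⁻ xs d in AllP.++⁻ˡ xs a ∷ dxs , AllP.++⁻ʳ xs a ∷ cross

distinct-last : ∀ xs {x} → Distinct (xs ++ x ∷ []) → All (_≢ x) xs
distinct-last xs d = All-map All.head (proj₂ (distinct-++⁻ xs d))

distinct-prefix : ∀ xs x ys → Distinct (xs ++ x ∷ ys) → Distinct (xs ++ x ∷ [])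
distinct-prefix xs x ys d = proj₁ (distinct-++⁻ (xs ++ x ∷ []) (subst Distinct (sym (++-assoc xs (x ∷ []) ys)) d))

letter-new-to-row : ∀ T R {x} → Distinct (reading (R ∷ T) ++ x ∷ []) → All (_≢ x) R
letter-new-to-row T R d = AllP.++⁻ʳ (reading T) (distinct-last (reading T ++ R) d)

insert-tableau : ∀ T x → Tableau T → Distinct (reading T ++ x ∷ []) →
  (reading T ++ x ∷ []) ~ reading (insertTab x T) × Tableau (insertTab x T)
insert-tableau [] x _ _ = ~refl , ([] ∷ [] , tt) ∷ []
insert-tableau (R ∷ T) x ((iR , bR) ∷ tT) d with insertRow x R | rowInsertion x R
... | (R' , nothing) | v =
  ≡⇒~ (trans (++-assoc (reading T) R _) (cong (reading T ++_) (sym (appended v)))) ,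
  (row-increasing iR (letter-new-to-row T R d) v , belowFirst-dominated R' R T (inserted-dominated v) bR) ∷ tT
... | (R' , just y) | v =
  ~trans row-step (~trans (≡⇒~ (sym (++-assoc (reading T) (y ∷ []) R'))) (~suffix R' (proj₁ below))) ,
  (row-increasing iR x∉R v , belowFirst-insert T bR iR v) ∷ proj₂ below
  where
  x∉R : All (_≢ x) R
  x∉R = letter-new-to-row T R d
  row-step : ((reading T ++ R) ++ x ∷ []) ~ (reading T ++ y ∷ R')
  row-step = ~trans (≡⇒~ (++-assoc (reading T) R _)) (~prefix (reading T) (row-knuth iR x∉R v))
  below : (reading T ++ y ∷ []) ~ reading (insertTab y T) × Tableau (insertTab y T)
  below = insert-tableau T y tT (distinct-prefix (reading T) y R' (~distinct row-step d))

insert-all : ∀ T xs → Tableau T → Distinct (reading T ++ xs) →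
  (reading T ++ xs) ~ reading (foldl (λ t x → insertTab x t) T xs) × Tableau (foldl (λ t x → insertTab x t) T xs)
insert-all T [] tT _ = ≡⇒~ (++-identityʳ (reading T)) , tT
insert-all T (x ∷ xs) tT d =
  let first , tT' = insert-tableau T x tT (distinct-prefix (reading T) x xs d)
      step = ~trans (≡⇒~ (sym (++-assoc (reading T) (x ∷ []) xs))) (~suffix xs first)
      rest , tT'' = insert-all (insertTab x T) xs tT' (~distinct step d)
  in ~trans step rest , tT''

insertion-tableau : ∀ w → Distinct w → w ~ reading (insertionTableau w) × Tableau (insertionTableau w)
insertion-tableau w = insert-all [] w []

psum : ℕ → List ℕ → ℕ
psum zero _ = 0
psum (suc k) [] = 0
psum (suc k) (a ∷ as) = a + psum k as

chains-sublist : ∀ {xs ys} → xs ⊆ ys → Chains ys → Chains xs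
chains-sublist [] c = tt
chains-sublist (_ ∷ʳ p) (_ , c) = chains-sublist p c
chains-sublist (refl ∷ p) (a , c) = All-resp-⊆ p a , chains-sublist p c

labelledReading : List Labelled → Labelled
labelledReading [] = []
labelledReading (R ∷ T) = labelledReading T ++ R

firstColumn : List Labelled → Labelled
firstColumn [] = []
firstColumn (R ∷ T) = firstColumn T ++ take 1 R

otherColumns : List Labelled → List Labelled
otherColumns = map (drop 1)

otherColumns-sublist : ∀ T → labelledReading (otherColumns T) ⊆ labelledReading T
otherColumns-sublist [] = []
otherColumns-sublist ([] ∷ T) = Sublist.++⁺ (otherColumns-sublist T) []
otherColumns-sublist ((p ∷ R) ∷ T) = Sublist.++⁺ (otherColumns-sublist T) (p ∷ʳ ⊆-refl)

size-columns : ∀ T → size (labelledReading T) ≡ size (labelledReading (otherColumns T)) + size (firstColumn T)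
size-columns [] = refl
size-columns (R ∷ T) = begin
  size (labelledReading T ++ R)                       ≡⟨ size-++ (labelledReading T) R ⟩
  size (labelledReading T) + size R                   ≡⟨ cong₂ _+_ (size-columns T) (size-row R) ⟩
  (a + b) + (c + d)                                   ≡⟨ interchange a b c d ⟩
  (a + c) + (b + d)                                   ≡⟨ sym (cong₂ _+_ (size-++ (labelledReading (otherColumns T)) (drop 1 R))
                                                                      (size-++ (firstColumn T) (take 1 R))) ⟩
  size (labelledReading (otherColumns T) ++ drop 1 R) + size (firstColumn T ++ take 1 R) ∎
  where
  open ≡-Reasoning
  a = size (labelledReading (otherColumns T))
  b = size (firstColumn T)
  c = size (drop 1 R)
  d = size (take 1 R)
  size-row : ∀ R → size R ≡ size (drop 1 R) + size (take 1 R)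
  size-row [] = refl
  size-row ((_ , zero) ∷ R) = sym (+-identityʳ (size R))
  size-row ((_ , suc _) ∷ R) = +-comm 1 (size R)

usedLabels : Labelled → List ℕ
usedLabels [] = []
usedLabels ((_ , zero) ∷ s) = usedLabels s
usedLabels ((_ , suc l) ∷ s) = suc l ∷ usedLabels s

length-usedLabels : ∀ s → length (usedLabels s) ≡ size s
length-usedLabels [] = refl
length-usedLabels ((_ , zero) ∷ s) = length-usedLabels s
length-usedLabels ((_ , suc l) ∷ s) = cong suc (length-usedLabels s)

usedLabels-++ : ∀ a b → usedLabels (a ++ b) ≡ usedLabels a ++ usedLabels b
usedLabels-++ [] b = refl
usedLabels-++ ((_ , zero) ∷ a) b = usedLabels-++ a b
usedLabels-++ ((_ , suc l) ∷ a) b = cong (suc l ∷_) (usedLabels-++ a b)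

usedLabels-all : ∀ {P : ℕ → Set} s → All (λ p → 0 < proj₂ p → P (proj₂ p)) s → All P (usedLabels s)
usedLabels-all [] [] = []
usedLabels-all ((_ , zero) ∷ s) (_ ∷ a) = usedLabels-all s a
usedLabels-all ((_ , suc l) ∷ s) (p ∷ a) = p (s≤s z≤n) ∷ usedLabels-all s a

distinct-in-range : ∀ k xs → Distinct xs → All (λ l → 0 < l × l ≤ k) xs → length xs ≤ k
distinct-in-range zero [] _ _ = z≤n
distinct-in-range zero (_ ∷ _) _ ((p , q) ∷ _) = ⊥-elim (<-irrefl refl (<-≤-trans p q))
distinct-in-range (suc k) xs d b =
  ≤-trans (remove-length xs d)
    (s≤s (distinct-in-range k (remove xs) (remove-distinct xs d) (All-map lower (remove-all xs b))))
  where
  remove : List ℕ → List ℕ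
  remove [] = []
  remove (x ∷ xs) with x ≟ suc k
  ... | yes _ = remove xs
  ... | no _ = x ∷ remove xs
  remove-all : ∀ {P : ℕ → Set} xs → All P xs → All (λ x → x ≢ suc k × P x) (remove xs)
  remove-all [] [] = []
  remove-all (x ∷ xs) (p ∷ ps) with x ≟ suc k
  ... | yes _ = remove-all xs ps
  ... | no n = (n , p) ∷ remove-all xs ps
  remove-distinct : ∀ xs → Distinct xs → Distinct (remove xs)
  remove-distinct [] [] = []
  remove-distinct (x ∷ xs) (a ∷ p) with x ≟ suc k
  ... | yes _ = remove-distinct xs p
  ... | no _ = All-map proj₂ (remove-all xs a) ∷ remove-distinct xs p
  remove-absent : ∀ xs → All (suc k ≢_) xs → length (remove xs) ≡ length xs
  remove-absent [] [] = refl
  remove-absent (x ∷ xs) (n ∷ a) with x ≟ suc k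
  ... | yes e = ⊥-elim (n (sym e))
  ... | no _ = cong suc (remove-absent xs a)
  remove-length : ∀ xs → Distinct xs → length xs ≤ suc (length (remove xs))
  remove-length [] [] = z≤n
  remove-length (x ∷ xs) (a ∷ p) with x ≟ suc k
  ... | yes refl = s≤s (≤-reflexive (sym (remove-absent xs a)))
  ... | no _ = s≤s (remove-length xs p)
  lower : ∀ {l} → l ≢ suc k × (0 < l × l ≤ suc k) → 0 < l × l ≤ k
  lower (n , p , q) = p , ≤-pred (≤∧≢⇒< q n)

firstColumn-sublist : ∀ T → firstColumn T ⊆ labelledReading T
firstColumn-sublist [] = []
firstColumn-sublist ([] ∷ T) = Sublist.++⁺ (firstColumn-sublist T) []
firstColumn-sublist ((p ∷ R) ∷ T) = Sublist.++⁺ (firstColumn-sublist T) (refl ∷ minimum R)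

chains-before : ∀ A v c rest → Chains (A ++ (v , c) ∷ rest) → All (λ p → 0 < proj₂ p → c ≡ proj₂ p → proj₁ p < v) A
chains-before [] v c rest _ = []
chains-before ((e , l) ∷ A) v c rest (a , ch) = at-v (AllP.++⁻ʳ A a) ∷ chains-before A v c rest ch
  where
  at-v : Above l e ((v , c) ∷ rest) → 0 < l → c ≡ l → e < v
  at-v (h ∷ _) p q = h p q

below-head : ∀ v c R T → Tableau (map values (((v , c) ∷ R) ∷ T)) → All (λ q → v < proj₁ q) (firstColumn T)
below-head v c R [] _ = []
below-head v c R ([] ∷ T) (_ ∷ t) = AllP.++⁺ (all-empty T t) []
  where
  all-empty : ∀ T → Tableau (map values ([] ∷ T)) → All (λ q → v < proj₁ q) (firstColumn T)
  all-empty [] _ = []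
  all-empty ([] ∷ T) (_ ∷ t) = AllP.++⁺ (all-empty T t) []
  all-empty ((_ ∷ _) ∷ T) ((_ , ()) ∷ _)
below-head v c R (((v₂ , c₂) ∷ R₂) ∷ T) ((_ , (v<v₂ , _)) ∷ t) =
  AllP.++⁺ (All-map (<-trans v<v₂) (below-head v₂ c₂ R₂ T t)) (v<v₂ ∷ [])

-- The used entries of the first column of a labelled tableau lie in distinct classes:
-- reading the column from the bottom, values decrease.
firstColumn-distinct : ∀ T → Tableau (map values T) → Chains (labelledReading T) → Distinct (usedLabels (firstColumn T))
firstColumn-distinct [] _ _ = []
firstColumn-distinct ([] ∷ T) (_ ∷ t) ch rewrite ++-identityʳ (firstColumn T) =
  firstColumn-distinct T t (subst Chains (++-identityʳ (labelledReading T)) ch)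
firstColumn-distinct (((x , zero) ∷ R) ∷ T) (_ ∷ t) ch
  rewrite usedLabels-++ (firstColumn T) ((x , zero) ∷ []) | ++-identityʳ (usedLabels (firstColumn T)) =
  firstColumn-distinct T t (chains-sublist (Sublist.++⁺ʳ _ ⊆-refl) ch)
firstColumn-distinct (((x , suc c) ∷ R) ∷ T) t@(_ ∷ t') ch rewrite usedLabels-++ (firstColumn T) ((x , suc c) ∷ []) =
  AllPairsP.++⁺ (firstColumn-distinct T t' (chains-sublist (Sublist.++⁺ʳ _ ⊆-refl) ch)) ([] ∷ [])
    (All-map (_∷ []) (usedLabels-all (firstColumn T)
      (other-classes (below-head x (suc c) R T t)
        (All-resp-⊆ (firstColumn-sublist T) (chains-before (labelledReading T) x (suc c) R ch)))))
  where
  other-classes : ∀ {s} → All (λ q → x < proj₁ q) s → All (λ p → 0 < proj₂ p → suc c ≡ proj₂ p → proj₁ p < x) s →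
                  All (λ p → 0 < proj₂ p → proj₂ p ≢ suc c) s
  other-classes [] [] = []
  other-classes (g ∷ gs) (h ∷ hs) = (λ p e → <-asym g (h p (sym e))) ∷ other-classes gs hs

nonzero : List ℕ → ℕ
nonzero [] = 0
nonzero (zero ∷ as) = nonzero as
nonzero (suc _ ∷ as) = suc (nonzero as)

nonzeroAmong : ℕ → List ℕ → ℕ
nonzeroAmong zero _ = 0
nonzeroAmong (suc k) [] = 0
nonzeroAmong (suc k) (zero ∷ as) = nonzeroAmong k as
nonzeroAmong (suc k) (suc _ ∷ as) = suc (nonzeroAmong k as)

ZerosLast : List ℕ → Set
ZerosLast [] = ⊤
ZerosLast (zero ∷ as) = All (_≡ 0) as
ZerosLast (suc _ ∷ as) = ZerosLast as

nonzero-zeros : ∀ as → All (_≡ 0) as → nonzero as ≡ 0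
nonzero-zeros [] [] = refl
nonzero-zeros (.0 ∷ as) (refl ∷ a) = nonzero-zeros as a

min-nonzeroAmong : ∀ k lens → ZerosLast lens → k ⊓ nonzero lens ≤ nonzeroAmong k lens
min-nonzeroAmong zero lens _ = z≤n
min-nonzeroAmong (suc k) [] _ = z≤n
min-nonzeroAmong (suc k) (zero ∷ as) z rewrite nonzero-zeros as z = z≤n
min-nonzeroAmong (suc k) (suc a ∷ as) z = s≤s (min-nonzeroAmong k as z)

psum-columns : ∀ k l → psum k l ≡ psum k (map pred l) + nonzeroAmong k l
psum-columns zero l = refl
psum-columns (suc k) [] = refl
psum-columns (suc k) (zero ∷ as) = psum-columns k as
psum-columns (suc k) (suc a ∷ as) = begin
  suc a + psum k as                 ≡⟨ cong (suc a +_) (psum-columns k as) ⟩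
  suc (a + (x + y))                 ≡⟨ cong suc (sym (+-assoc a x y)) ⟩
  suc ((a + x) + y)                 ≡⟨ sym (+-suc (a + x) y) ⟩
  (a + x) + suc y                   ∎
  where
  open ≡-Reasoning
  x = psum k (map pred as)
  y = nonzeroAmong k as

tableau-zerosLast : ∀ T → Tableau (map values T) → ZerosLast (map length T)
tableau-zerosLast [] _ = tt
tableau-zerosLast ([] ∷ T) t = below-empty T t
  where
  below-empty : ∀ T → Tableau (map values ([] ∷ T)) → All (_≡ 0) (map length T)
  below-empty [] _ = []
  below-empty ([] ∷ T) (_ ∷ t) = refl ∷ below-empty T t
  below-empty ((_ ∷ R) ∷ T) ((_ , ()) ∷ _)
tableau-zerosLast ((_ ∷ R) ∷ T) (_ ∷ t) = tableau-zerosLast T t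

firstColumn-size : ∀ k T → Tableau (map values T) → Chains (labelledReading T) → LabelsAtMost k (labelledReading T) →
  size (firstColumn T) ≤ nonzeroAmong k (map length T)
firstColumn-size k T t ch bd =
  ≤-trans (⊓-glb at-most-k at-most-rows) (min-nonzeroAmong k (map length T) (tableau-zerosLast T t))
  where
  at-most-k : size (firstColumn T) ≤ k
  at-most-k = subst (_≤ k) (length-usedLabels (firstColumn T))
    (distinct-in-range k _ (firstColumn-distinct T t ch)
      (usedLabels-all (firstColumn T) (All-map (λ q p → p , q) (All-resp-⊆ (firstColumn-sublist T) bd))))
  size≤length : ∀ s → size s ≤ length s
  size≤length [] = z≤n
  size≤length ((_ , zero) ∷ s) = m≤n⇒m≤1+n (size≤length s)
  size≤length ((_ , suc _) ∷ s) = s≤s (size≤length s)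
  length-firstColumn : ∀ T → length (firstColumn T) ≡ nonzero (map length T)
  length-firstColumn [] = refl
  length-firstColumn ([] ∷ T) = trans (length-++ (firstColumn T)) (trans (+-identityʳ _) (length-firstColumn T))
  length-firstColumn ((_ ∷ R) ∷ T) = trans (length-++ (firstColumn T)) (trans (+-comm _ 1) (cong suc (length-firstColumn T)))
  at-most-rows : size (firstColumn T) ≤ nonzero (map length T)
  at-most-rows = subst (size (firstColumn T) ≤_) (length-firstColumn T) (size≤length (firstColumn T))

otherColumns-tableau : ∀ T → Tableau (map values T) → Tableau (map values (otherColumns T))
otherColumns-tableau [] _ = []
otherColumns-tableau (R ∷ T) ((iR , bR) ∷ t) = (rest-increasing R iR , rest-below R T bR) ∷ otherColumns-tableau T t
  where
  rest-increasing : ∀ R → Increasing (values R) → Increasing (values (drop 1 R))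
  rest-increasing [] i = i
  rest-increasing (_ ∷ R) (_ ∷ i) = i
  rest-below : ∀ U T → BelowFirst (values U) (map values T) → BelowFirst (values (drop 1 U)) (map values (otherColumns T))
  rest-below U [] _ = tt
  rest-below U ([] ∷ T) _ = tt
  rest-below [] ((_ ∷ _) ∷ T) ()
  rest-below (_ ∷ U) ((_ ∷ _) ∷ T) (_ , b) = b

length-otherColumns : ∀ T → map length (otherColumns T) ≡ map pred (map length T)
length-otherColumns [] = refl
length-otherColumns ([] ∷ T) = cong (0 ∷_) (length-otherColumns T)
length-otherColumns ((_ ∷ R) ∷ T) = cong (length R ∷_) (length-otherColumns T)

labelled-tableau-bound : ∀ k f T → Tableau (map values T) → All (λ R → length R ≤ f) T →
  Chains (labelledReading T) → LabelsAtMost k (labelledReading T) → size (labelledReading T) ≤ psum k (map length T)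
labelled-tableau-bound k zero T _ short _ _ = subst (_≤ psum k (map length T)) (sym (empty-size T short)) z≤n
  where
  empty-size : ∀ T → All (λ R → length R ≤ 0) T → size (labelledReading T) ≡ 0
  empty-size [] _ = refl
  empty-size ([] ∷ T) (_ ∷ a) = trans (cong size (++-identityʳ (labelledReading T))) (empty-size T a)
labelled-tableau-bound k (suc f) T t short ch bd = begin
  size (labelledReading T)                                                       ≡⟨ size-columns T ⟩
  size (labelledReading (otherColumns T)) + size (firstColumn T)                 ≤⟨ +-mono-≤ rest (firstColumn-size k T t ch bd) ⟩
  psum k (map pred (map length T)) + nonzeroAmong k (map length T)              ≡⟨ sym (psum-columns k (map length T)) ⟩
  psum k (map length T)                                                          ∎
  where
  open ≤-Reasoning
  shorter : ∀ R → length R ≤ suc f → length (drop 1 R) ≤ f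
  shorter [] _ = z≤n
  shorter (_ ∷ R) (s≤s q) = q
  rest : size (labelledReading (otherColumns T)) ≤ psum k (map pred (map length T))
  rest = subst (λ l → size (labelledReading (otherColumns T)) ≤ psum k l) (length-otherColumns T)
    (labelled-tableau-bound k f (otherColumns T) (otherColumns-tableau T t)
      (AllP.map⁺ (All-map (λ {R} → shorter R) short))
      (chains-sublist (otherColumns-sublist T) ch) (All-resp-⊆ (otherColumns-sublist T) bd))

split-rows : ∀ (L : Labelled) T → values L ≡ reading T →
  Σ (List Labelled) λ LT → map values LT ≡ T × L ≡ labelledReading LT
split-rows [] [] e = [] , refl , refl
split-rows (_ ∷ _) [] ()
split-rows L (R ∷ T) e with split L (reading T) R e
... | Lu , Lr , refl , e₂ , e₃ with split-rows Lu T e₂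
...   | LT , refl , refl = (Lr ∷ LT) , cong (_∷ map values LT) e₃ , refl

tableau-family-bound : ∀ k T n → Tableau T → Family k (reading T) n → n ≤ psum k (map length T)
tableau-family-bound k T n t (family L vl ch bd sz) with split-rows L T vl
... | LT , refl , refl =
  ≤-trans sz (subst (λ l → size (labelledReading LT) ≤ psum k l) (sym (lengths LT))
    (labelled-tableau-bound k _ LT t (rows-short LT) ch bd))
  where
  lengths : ∀ LT → map length (map values LT) ≡ map length LT
  lengths [] = refl
  lengths (R ∷ LT) = cong₂ _∷_ (length-map proj₁ R) (lengths LT)
  rows-short : ∀ LT → All (λ R → length R ≤ length (labelledReading LT)) LT
  rows-short [] = []
  rows-short (R ∷ LT) =
    subst (length R ≤_) (sym (length-++ (labelledReading LT))) (m≤n+m (length R) _) ∷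
    All-map (λ q → ≤-trans q (subst (length (labelledReading LT) ≤_) (sym (length-++ (labelledReading LT))) (m≤m+n _ _)))
      (rows-short LT)

-- The row family labels row j (counting from 0) by j+1 if j < k, and by 0 otherwise.
rowLabel : ℕ → ℕ → ℕ
rowLabel k j with j <? k
... | yes _ = suc j
... | no _ = 0

labelRow : ℕ → List ℕ → Labelled
labelRow c = map (λ v → v , c)

labelRows : ℕ → ℕ → List (List ℕ) → Labelled
labelRows k j [] = []
labelRows k j (R ∷ T) = labelRows k (suc j) T ++ labelRow (rowLabel k j) R

values-labelRows : ∀ k j T → values (labelRows k j T) ≡ reading T
values-labelRows k j [] = refl
values-labelRows k j (R ∷ T) =
  trans (values-++ (labelRows k (suc j) T) (labelRow (rowLabel k j) R))
        (cong₂ _++_ (values-labelRows k (suc j) T) (values-labelRow R))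
  where
  values-labelRow : ∀ R → values (labelRow (rowLabel k j) R) ≡ R
  values-labelRow [] = refl
  values-labelRow (x ∷ R) = cong (x ∷_) (values-labelRow R)

all-labelRow : ∀ {P : ℕ × ℕ → Set} c R → (∀ v → P (v , c)) → All P (labelRow c R)
all-labelRow c [] f = []
all-labelRow c (x ∷ R) f = f x ∷ all-labelRow c R f

chains-labelRow : ∀ c R → Increasing R → Chains (labelRow c R)
chains-labelRow c [] _ = tt
chains-labelRow c (x ∷ R) (a ∷ i) = above R a , chains-labelRow c R i
  where
  above : ∀ R → All (x <_) R → Above c x (labelRow c R)
  above [] [] = []
  above (y ∷ R) (p ∷ ps) = (λ _ _ → p) ∷ above R ps

chains-++ : ∀ A B → Chains A → Chains B → All (λ p → 0 < proj₂ p → All (λ q → proj₂ q ≢ proj₂ p) B) A → Chains (A ++ B)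
chains-++ [] B _ cB _ = cB
chains-++ ((v , l) ∷ A) B (a , cA) cB (d ∷ ds) = AllP.++⁺ a (disjoint B d) , chains-++ A B cA cB ds
  where
  disjoint : ∀ B → (0 < l → All (λ q → proj₂ q ≢ l) B) → Above l v B
  disjoint [] _ = []
  disjoint (q ∷ B) f = (λ p e → ⊥-elim (All.head (f p) e)) ∷ disjoint B (λ p → All.tail (f p))

labelRows-above : ∀ k j T → All (λ p → 0 < proj₂ p → j < proj₂ p) (labelRows k j T)
labelRows-above k j [] = []
labelRows-above k j (R ∷ T) =
  AllP.++⁺ (All-map (λ f p → <-trans (n<1+n j) (f p)) (labelRows-above k (suc j) T)) (all-labelRow _ R (λ v → label-above))
  where
  label-above : 0 < rowLabel k j → j < rowLabel k j
  label-above p with j <? k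
  ... | yes _ = ≤-refl
  ... | no _ = ⊥-elim (<-irrefl refl p)

rowLabel≤suc : ∀ k j → rowLabel k j ≤ suc j
rowLabel≤suc k j with j <? k
... | yes _ = ≤-refl
... | no _ = z≤n

-- Rows are increasing and distinct rows use distinct labels, so this is a chain family.
chains-labelRows : ∀ k j T → All Increasing T → Chains (labelRows k j T)
chains-labelRows k j [] _ = tt
chains-labelRows k j (R ∷ T) (iR ∷ iT) =
  chains-++ (labelRows k (suc j) T) (labelRow (rowLabel k j) R) (chains-labelRows k (suc j) T iT) (chains-labelRow _ R iR)
    (All-map (λ f q → all-labelRow (rowLabel k j) R (λ v e → <-irrefl e (≤-<-trans (rowLabel≤suc k j) (f q))))
      (labelRows-above k (suc j) T))

bounded-labelRows : ∀ k j T → LabelsAtMost k (labelRows k j T)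
bounded-labelRows k j [] = []
bounded-labelRows k j (R ∷ T) = AllP.++⁺ (bounded-labelRows k (suc j) T) (all-labelRow _ R (λ v → rowLabel≤k))
  where
  rowLabel≤k : rowLabel k j ≤ k
  rowLabel≤k with j <? k
  ... | yes p = p
  ... | no _ = z≤n

size-labelRows : ∀ k j T → size (labelRows k j T) ≡ psum (k ∸ j) (map length T)
size-labelRows k j [] with k ∸ j
... | zero = refl
... | suc _ = refl
size-labelRows k j (R ∷ T) with j <? k
... | yes j<k = begin
  size (labelRows k (suc j) T ++ labelRow (suc j) R)      ≡⟨ size-++ (labelRows k (suc j) T) _ ⟩
  size (labelRows k (suc j) T) + size (labelRow (suc j) R) ≡⟨ cong₂ _+_ (size-labelRows k (suc j) T) (size-used R) ⟩
  psum (k ∸ suc j) (map length T) + length R              ≡⟨ +-comm _ (length R) ⟩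
  psum (suc (k ∸ suc j)) (map length (R ∷ T))             ≡⟨ cong (λ t → psum t (map length (R ∷ T))) (sym (+-∸-assoc 1 j<k)) ⟩
  psum (k ∸ j) (map length (R ∷ T))                       ∎
  where
  open ≡-Reasoning
  size-used : ∀ R → size (labelRow (suc j) R) ≡ length R
  size-used [] = refl
  size-used (x ∷ R) = cong suc (size-used R)
... | no j≮k = begin
  size (labelRows k (suc j) T ++ labelRow 0 R)            ≡⟨ size-++ (labelRows k (suc j) T) _ ⟩
  size (labelRows k (suc j) T) + size (labelRow 0 R)      ≡⟨ cong₂ _+_ (size-labelRows k (suc j) T) (size-unused R) ⟩
  psum (k ∸ suc j) (map length T) + 0                     ≡⟨ +-identityʳ _ ⟩
  psum (k ∸ suc j) (map length T)                         ≡⟨ cong (λ t → psum t (map length T)) (m≤n⇒m∸n≡0 (m≤n⇒m≤1+n k≤j)) ⟩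
  0                                                       ≡⟨ cong (λ t → psum t (map length (R ∷ T))) (sym (m≤n⇒m∸n≡0 k≤j)) ⟩
  psum (k ∸ j) (map length (R ∷ T))                       ∎
  where
  open ≡-Reasoning
  k≤j : k ≤ j
  k≤j = ≮⇒≥ j≮k
  size-unused : ∀ R → size (labelRow 0 R) ≡ 0
  size-unused [] = refl
  size-unused (x ∷ R) = size-unused R

tableau-family : ∀ k T → Tableau T → Family k (reading T) (psum k (map length T))
tableau-family k T t =
  family (labelRows k 0 T) (values-labelRows k 0 T) (chains-labelRows k 0 T (rows-increasing t))
         (bounded-labelRows k 0 T) (≤-reflexive (sym (size-labelRows k 0 T)))

shape : List ℕ → List ℕ
shape w = map length (insertionTableau w)

greene-lower : ∀ k w → Distinct w → Family k w (psum k (shape w))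
greene-lower k w d =
  let w~P , tableau = insertion-tableau w d
  in ~family (~sym w~P) (tableau-family k (insertionTableau w) tableau)

greene-upper : ∀ k w n → Distinct w → Family k w n → n ≤ psum k (shape w)
greene-upper k w n d F =
  let w~P , tableau = insertion-tableau w d
  in tableau-family-bound k (insertionTableau w) n tableau (~family w~P F)

mapValues : (ℕ → ℕ) → Labelled → Labelled
mapValues g = map (λ p → g (proj₁ p) , proj₂ p)

IncreasingOnClass : (ℕ → ℕ) → ℕ × ℕ → ℕ × ℕ → Set
IncreasingOnClass g p₁ p₂ = 0 < proj₂ p₁ → proj₂ p₂ ≡ proj₂ p₁ → proj₁ p₁ < proj₁ p₂ → g (proj₁ p₁) < g (proj₁ p₂)

family-mapValues : ∀ k g L n → Chains L → LabelsAtMost k L → n ≤ size L → AllPairs (IncreasingOnClass g) L →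
  Family k (map g (values L)) n
family-mapValues k g L n ch bd sz mono =
  family (mapValues g L) (values-map L) (chains-map L ch mono) (bounded-map L bd) (subst (n ≤_) (sym (size-map L)) sz)
  where
  values-map : ∀ L → values (mapValues g L) ≡ map g (values L)
  values-map [] = refl
  values-map (_ ∷ L) = cong (_ ∷_) (values-map L)
  chains-map : ∀ L → Chains L → AllPairs (IncreasingOnClass g) L → Chains (mapValues g L)
  chains-map [] _ _ = tt
  chains-map ((v , l) ∷ L) (a , c) (m ∷ ms) = above L a m , chains-map L c ms
    where
    above : ∀ L → Above l v L → All (IncreasingOnClass g (v , l)) L → Above l (g v) (mapValues g L)
    above [] [] [] = []
    above (_ ∷ L) (x ∷ xs) (y ∷ ys) = (λ p e → y p e (x p e)) ∷ above L xs ys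
  bounded-map : ∀ L → LabelsAtMost k L → LabelsAtMost k (mapValues g L)
  bounded-map [] [] = []
  bounded-map (_ ∷ L) (b ∷ bs) = b ∷ bounded-map L bs
  size-map : ∀ L → size (mapValues g L) ≡ size L
  size-map [] = refl
  size-map ((_ , zero) ∷ L) = size-map L
  size-map ((_ , suc _) ∷ L) = cong suc (size-map L)

a≢1+a : ∀ a → a ≢ suc a
a≢1+a a e = 1+n≢n (sym e)

swap-twice : ∀ a w → map (swapℕ a (suc a)) (map (swapℕ a (suc a)) w) ≡ w
swap-twice a w = trans (sym (map-∘ w)) (trans (map-cong (λ v → swap-involutive a (suc a) v (a≢1+a a)) w) (map-id w))

swap-reverses-order : ∀ a w → AllPairs (λ u v → ¬ (u ≡ suc a × v ≡ a)) w →
  AllPairs (λ u v → ¬ (u ≡ a × v ≡ suc a)) (map (swapℕ a (suc a)) w)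
swap-reverses-order a w order = AllPairsP.map⁺ (AllPairs-map unswap order)
  where
  unswapped : ∀ {u c d} → swapℕ a (suc a) u ≡ c → swapℕ a (suc a) c ≡ d → u ≡ d
  unswapped {u} refl e = trans (sym (swap-involutive a (suc a) u (a≢1+a a))) e
  unswap : ∀ {u v} → ¬ (u ≡ suc a × v ≡ a) → ¬ (swapℕ a (suc a) u ≡ a × swapℕ a (suc a) v ≡ suc a)
  unswap no-pair (e₁ , e₂) =
    no-pair (unswapped e₁ (swap-left a (suc a)) , unswapped e₂ (swap-right a (suc a) (a≢1+a a)))

adjacent-swap-monotone : ∀ a u v → u < v → ¬ (u ≡ a × v ≡ suc a) → swapℕ a (suc a) u < swapℕ a (suc a) v
adjacent-swap-monotone a u v u<v not-ab =
  swap-cases (λ su → su < sv) a (suc a) u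
    (λ { refl → swap-cases (suc a <_) a (suc a) v
           (λ { refl → ⊥-elim (<-irrefl refl u<v) })
           (λ v≡sa → ⊥-elim (not-ab (refl , v≡sa)))
           (λ _ v≢sa → ≤∧≢⇒< u<v (λ e → v≢sa (sym e))) })
    (λ { refl → swap-cases (a <_) a (suc a) v
           (λ { refl → ⊥-elim (<-asym u<v (n<1+n a)) })
           (λ { refl → ⊥-elim (<-irrefl refl u<v) })
           (λ _ _ → <-trans (n<1+n a) u<v) })
    (λ u≢a u≢sa → swap-cases (u <_) a (suc a) v
           (λ { refl → <-trans u<v (n<1+n a) })
           (λ { refl → ≤∧≢⇒< (≤-pred u<v) u≢a })
           (λ _ _ → u<v))
  where
  sv = swapℕ a (suc a) v

swap-keeps-family : ∀ k a w n → AllPairs (λ u v → ¬ (u ≡ a × v ≡ suc a)) w →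
  Family k w n → Family k (map (swapℕ a (suc a)) w) n
swap-keeps-family k a w n order (family L refl ch bd sz) =
  family-mapValues k (swapℕ a (suc a)) L n ch bd sz (increasing L order)
  where
  increasing : ∀ L → AllPairs (λ u v → ¬ (u ≡ a × v ≡ suc a)) (values L) →
               AllPairs (IncreasingOnClass (swapℕ a (suc a))) L
  increasing [] [] = []
  increasing (p ∷ L) (o ∷ os) =
    All-map (λ o _ _ lt → adjacent-swap-monotone a _ _ lt o) (AllP.map⁻ o) ∷ increasing L os

unuse : ℕ → Labelled → Labelled
unuse c [] = []
unuse c ((v , l) ∷ L) with v ≟ c
... | yes _ = (v , 0) ∷ unuse c L
... | no _ = (v , l) ∷ unuse c L

module Unuse (c : ℕ) where

  values-unuse : ∀ L → values (unuse c L) ≡ values L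
  values-unuse [] = refl
  values-unuse ((v , l) ∷ L) with v ≟ c
  ... | yes _ = cong (v ∷_) (values-unuse L)
  ... | no _ = cong (v ∷_) (values-unuse L)

  chains-unuse : ∀ L → Chains L → Chains (unuse c L)
  chains-unuse [] _ = tt
  chains-unuse ((v , l) ∷ L) (a , ch) with v ≟ c
  ... | yes _ = above-unused v _ , chains-unuse L ch
  ... | no _ = above L a , chains-unuse L ch
    where
    above : ∀ L → Above l v L → Above l v (unuse c L)
    above [] [] = []
    above ((v₂ , l₂) ∷ L) (x ∷ xs) with v₂ ≟ c
    ... | yes _ = (λ p e → ⊥-elim (<-irrefl e p)) ∷ above L xs
    ... | no _ = x ∷ above L xs

  bounded-unuse : ∀ k L → LabelsAtMost k L → LabelsAtMost k (unuse c L)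
  bounded-unuse k [] [] = []
  bounded-unuse k ((v , l) ∷ L) (b ∷ bs) with v ≟ c
  ... | yes _ = z≤n ∷ bounded-unuse k L bs
  ... | no _ = b ∷ bounded-unuse k L bs

  unused : ∀ L → All (λ p → proj₁ p ≡ c → proj₂ p ≡ 0) (unuse c L)
  unused [] = []
  unused ((v , l) ∷ L) with v ≟ c
  ... | yes _ = (λ _ → refl) ∷ unused L
  ... | no v≢c = (λ e → ⊥-elim (v≢c e)) ∷ unused L

  unuse-absent : ∀ L → All (_≢ c) (values L) → unuse c L ≡ L
  unuse-absent [] [] = refl
  unuse-absent ((v , l) ∷ L) (v≢c ∷ a) with v ≟ c
  ... | yes e = ⊥-elim (v≢c e)
  ... | no _ = cong ((v , l) ∷_) (unuse-absent L a)

  size-unuse : ∀ L → Distinct (values L) → size L ≤ suc (size (unuse c L))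
  size-unuse [] _ = z≤n
  size-unuse ((v , l) ∷ L) (a ∷ d) with v ≟ c
  ... | yes refl = subst (λ L' → size ((v , l) ∷ L) ≤ suc (size L')) (sym (unuse-absent L (All-map (λ n e → n (sym e)) a)))
                     (lose-one l)
    where
    lose-one : ∀ l → size ((v , l) ∷ L) ≤ suc (size L)
    lose-one zero = n≤1+n _
    lose-one (suc _) = ≤-refl
  ... | no _ = keep l
    where
    keep : ∀ l → size ((v , l) ∷ L) ≤ suc (size ((v , l) ∷ unuse c L))
    keep zero = size-unuse L d
    keep (suc _) = s≤s (size-unuse L d)

-- Exchanging a and a+1 in a word of distinct letters loses at most one letter of a
-- k-family: the letter a+1 leaves its class, after which no class contains a before a+1.
swap-costs-one : ∀ k a w n → Distinct w → Family k w n → Family k (map (swapℕ a (suc a)) w) (n ∸ 1)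
swap-costs-one k a w n d (family L refl ch bd sz) =
  subst (λ u → Family k (map (swapℕ a (suc a)) u) (n ∸ 1)) (values-unuse L)
    (family-mapValues k (swapℕ a (suc a)) L' (n ∸ 1) (chains-unuse L ch) (bounded-unuse k L bd) smaller
      (increasing L' (unused L)))
  where
  open Unuse (suc a)
  L' = unuse (suc a) L
  smaller : n ∸ 1 ≤ size L'
  smaller = ∸-monoˡ-≤ 1 (≤-trans sz (size-unuse L d))
  increasing : ∀ L → All (λ p → proj₁ p ≡ suc a → proj₂ p ≡ 0) L → AllPairs (IncreasingOnClass (swapℕ a (suc a))) L
  increasing [] [] = []
  increasing (_ ∷ L) (_ ∷ us) =
    All-map (λ {p₂} u₂ p e lt → adjacent-swap-monotone a _ _ lt
      (λ { (_ , v₂≡sa) → <-irrefl (sym (trans (sym e) (u₂ v₂≡sa))) p })) us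
    ∷ increasing L us

partialSum≡psum : ∀ l j → partialSum l j ≡ psum j l
partialSum≡psum l zero = refl
partialSum≡psum l (suc j) = trans (cong (_+ part l (suc j)) (partialSum≡psum l j)) (sym (psum-suc j l))
  where
  psum-suc : ∀ j l → psum (suc j) l ≡ psum j l + part l (suc j)
  psum-suc zero [] = refl
  psum-suc (suc j) [] = refl
  psum-suc zero (x ∷ l) = +-comm x 0
  psum-suc (suc j) (x ∷ l) = trans (cong (x +_) (psum-suc j l)) (sym (+-assoc x (psum j l) _))

oneLine-distinct : ∀ {m} (σ : Permutation′ m) → Distinct (oneLine σ)
oneLine-distinct {m} σ = AllPairsP.map⁺ (AllPairsP.tabulate⁺-< (λ i<j e → FinP.<⇒≢ i<j (injective e)))
  where
  injective : ∀ {i j} → suc (toℕ (σ ⟨$⟩ʳ i)) ≡ suc (toℕ (σ ⟨$⟩ʳ j)) → i ≡ j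
  injective {i} {j} e =
    trans (sym (inverseˡ σ)) (trans (cong (σ ⟨$⟩ˡ_) (FinP.toℕ-injective (suc-injective e))) (inverseˡ σ))

module _ {n : ℕ} (i : Fin n) (π : Permutation′ (suc n)) where

  -- The paper's values i, i+1 are a = suc (toℕ i), a+1 in one-line notation.
  private
    a = suc (toℕ i)
    s = swapℕ a (suc a)
    τ = π ∘ₚ transpose (inject₁ i) (Data.Fin.suc i)
    w = oneLine π

  oneLine-transpose : oneLine τ ≡ map s w
  oneLine-transpose = trans (map-cong (λ k → value (π ⟨$⟩ʳ k)) (allFin (suc n))) (map-∘ (allFin (suc n)))
    where
    toℕ-inject : toℕ (inject₁ i) ≡ toℕ i
    toℕ-inject = FinP.toℕ-inject₁ i
    value : ∀ z → suc (toℕ (PermC.transpose (inject₁ i) (Data.Fin.suc i) z)) ≡ s (suc (toℕ z))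
    value z with z Data.Fin.≟ inject₁ i
    ... | yes refl = trans (sym (swap-left a (suc a))) (cong (λ t → s (suc t)) (sym toℕ-inject))
    ... | no z≢i with z Data.Fin.≟ Data.Fin.suc i
    ...   | yes refl = trans (cong suc toℕ-inject) (sym (swap-right a (suc a) (a≢1+a a)))
    ...   | no z≢si = sym (swap-other a (suc a) (suc (toℕ z))
                        (λ e → z≢i (FinP.toℕ-injective (trans (suc-injective e) (sym toℕ-inject))))
                        (λ e → z≢si (FinP.toℕ-injective (suc-injective e))))

  oneLine-order : π ⟨$⟩ˡ inject₁ i Data.Fin.< π ⟨$⟩ˡ Data.Fin.suc i →
    AllPairs (λ u v → ¬ (u ≡ suc a × v ≡ a)) w
  oneLine-order i-first = AllPairsP.map⁺ (AllPairsP.tabulate⁺-<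
    (λ k<k' (e₁ , e₂) → <-asym k<k' (subst₂ Data.Fin._<_ (position-of-a e₂) (position-of-sa e₁) i-first)))
    where
    position-of-sa : ∀ {k} → suc (toℕ (π ⟨$⟩ʳ k)) ≡ suc a → π ⟨$⟩ˡ Data.Fin.suc i ≡ k
    position-of-sa e = trans (cong (π ⟨$⟩ˡ_) (sym (FinP.toℕ-injective (suc-injective e)))) (inverseˡ π)
    position-of-a : ∀ {k} → suc (toℕ (π ⟨$⟩ʳ k)) ≡ a → π ⟨$⟩ˡ inject₁ i ≡ k
    position-of-a e =
      trans (cong (π ⟨$⟩ˡ_) (sym (FinP.toℕ-injective (trans (suc-injective e) (sym (FinP.toℕ-inject₁ i)))))) (inverseˡ π)

  -- A maximal k-family of τ, with a and a+1 exchanged back, is a k-family of π.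
  τ-below-π : π ⟨$⟩ˡ inject₁ i Data.Fin.< π ⟨$⟩ˡ Data.Fin.suc i →
    ∀ k → psum k (rskShape τ) ≤ psum k (rskShape π)
  τ-below-π i-first k =
    greene-upper k w _ (oneLine-distinct π)
      (≡-family (swap-twice a w)
        (swap-keeps-family k a (map s w) _ (swap-reverses-order a w (oneLine-order i-first))
          (≡-family oneLine-transpose (greene-lower k (oneLine τ) (oneLine-distinct τ)))))

  -- A maximal k-family of π, with a and a+1 exchanged, is a k-family of τ up to one letter.
  π-below-τ+1 : ∀ k → psum k (rskShape π) ≤ psum k (rskShape τ) + 1
  π-below-τ+1 k =
    ∸1-bound (greene-upper k (oneLine τ) _ (oneLine-distinct τ)
      (≡-family (sym oneLine-transpose) (swap-costs-one k a w _ (oneLine-distinct π)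
        (greene-lower k w (oneLine-distinct π)))))
    where
    ∸1-bound : ∀ {m o} → m ∸ 1 ≤ o → m ≤ o + 1
    ∸1-bound {m} {o} le = ≤-trans (m≤n+m∸n m 1) (subst (suc (m ∸ 1) ≤_) (+-comm 1 o) (s≤s le))

-- The two comparisons, read through partialSum.
proposition2p1 : (n : ℕ) (i : Fin n) (π : Permutation′ (suc n)) →
    π ⟨$⟩ˡ inject₁ i Data.Fin.< π ⟨$⟩ˡ Data.Fin.suc i →
    (j : ℕ) → 1 ≤ j → j ≤ suc n →
    (partialSum (rskShape (π ∘ₚ transpose (inject₁ i) (Data.Fin.suc i))) j ≤ partialSum (rskShape π) j)
    × (partialSum (rskShape π) j ≤ partialSum (rskShape (π ∘ₚ transpose (inject₁ i) (Data.Fin.suc i))) j + 1)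
proposition2p1 n i π i-first j _ _ =
  subst₂ _≤_ (sym (partialSum≡psum _ j)) (sym (partialSum≡psum _ j)) (τ-below-π i π i-first j) ,
  subst₂ _≤_ (sym (partialSum≡psum _ j)) (cong (_+ 1) (sym (partialSum≡psum _ j))) (π-below-τ+1 i π j)
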